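{- Let $M$ and $L$ be complete linear lattices and let $\varphi,\psi: M\to\mathcal{I}_L$ be decreasing surjective correspondences from $M$ to $L$. Then the inverse correspondences $\varphi^{ -1},\psi^{ -1}$ are maps $L\to\mathcal{I}_M$, they are decreasing, and $\varphi\sqsubseteq\psi$ if and only if $\varphi^{ -1}\sqsubseteq\psi^{ -1}$.
   Context: A correspondence $\varphi$ from $M$ to $L$ is a map $M\to 2^L$; $\mathrm{graph}(\varphi)=\{(x,y): y\in\varphi(x)\}$, $\mathrm{dom}(\varphi)=\{x:\varphi(x)\ne\emptyset\}$; the inverse correspondence is $\varphi^{ -1}(y)=\{x\in M: y\in\varphi(x)\}$, $y\in L$; $\varphi$ is surjective if $\mathrm{dom}(\varphi^{ -1})=L$. A correspondence $\varphi$ is decreasing if for all $(x_1,y_1),(x_2,y_2)\in\mathrm{graph}(\varphi)$ with $x_1\le x_2$ and $y_1\le y_2$ the rectangle $[x_1,x_2]\times[y_1,y_2]$ is contained in $\mathrm{graph}(\varphi)$ (here $[a,b]=\{z:a\le z\le b\}$). A subset $I$ of a linearly ordered set is a (preference) interval if it contains $[a,b]$ for all $a,b\in I$; $\mathcal{I}_L$ is the set of nonempty such intervals of $L$. For nonempty $Y_1,Y_2\subseteq L$, $Y_1\sqsubseteq Y_2$ means $y_1\wedge y_2\in Y_1$ and $y_1\vee y_2\in Y_2$ for all $y_1\in Y_1,y_2\in Y_2$. For maps $\varphi,\psi$ with values in $\mathcal{I}_L$, $\varphi\sqsubseteq\psi$ means $\varphi(x)\sqsubseteq\psi(x)$ for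 all $x$ (similarly for $\mathcal{I}_M$-valued maps). -}

module Defs where

open import Level using (Level; suc)
open import Data.Product using (Σ; ∃; _×_; _,_)
open import Data.Sum using (_⊎_; inj₁; inj₂)
open import Relation.Binary.Core using (Rel)
open import Relation.Binary.Structures using (IsTotalOrder)
open import Relation.Binary.PropositionalEquality using (_≡_)

Subset : ∀ {ℓ} → Set ℓ → Set (suc ℓ)
Subset {ℓ} A = A → Set ℓ

record CompleteLinearLattice (ℓ : Level) : Set (suc ℓ) where
  field
    Carrier      : Set ℓ
    _≤_          : Rel Carrier ℓ
    isTotalOrder : IsTotalOrder _≡_ _≤_
    sup          : Subset Carrier → Carrier
    sup-upper    : ∀ (S : Subset Carrier) x → S x → x ≤ sup S
    sup-least    : ∀ (S : Subset Carrier) u → (∀ x → S x → x ≤ u) → sup S ≤ u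
    inf          : Subset Carrier → Carrier
    inf-lower    : ∀ (S : Subset Carrier) x → S x → inf S ≤ x
    inf-greatest : ∀ (S : Subset Carrier) l → (∀ x → S x → l ≤ x) → l ≤ inf S

  open IsTotalOrder isTotalOrder public using (total)

  _∧_ : Carrier → Carrier → Carrier
  x ∧ y with total x y
  ... | inj₁ _ = x
  ... | inj₂ _ = y

  _∨_ : Carrier → Carrier → Carrier
  x ∨ y with total x y
  ... | inj₁ _ = y
  ... | inj₂ _ = x

  IsInterval : Subset Carrier → Set ℓ
  IsInterval I = ∀ a b → I a → I b → ∀ z → a ≤ z → z ≤ b → I z

  NonEmpty : Subset Carrier → Set ℓ
  NonEmpty I = ∃ λ z → I z

  IsNEInterval : Subset Carrier → Set ℓ
  IsNEInterval I = NonEmpty I × IsInterval I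

  _⊑_ : Subset Carrier → Subset Carrier → Set ℓ
  Y₁ ⊑ Y₂ = ∀ y₁ y₂ → Y₁ y₁ → Y₂ y₂ → Y₁ (y₁ ∧ y₂) × Y₂ (y₁ ∨ y₂)

open CompleteLinearLattice public using (Carrier)

module _ {ℓ : Level} (M L : CompleteLinearLattice ℓ) where
  private
    module M = CompleteLinearLattice M
    module L = CompleteLinearLattice L

  Correspondence : Set (suc ℓ)
  Correspondence = Carrier M → Subset (Carrier L)

  IntervalValued : Correspondence → Set ℓ
  IntervalValued φ = ∀ x → L.IsNEInterval (φ x)

  Surjective : Correspondence → Set ℓ
  Surjective φ = ∀ y → ∃ λ x → φ x y

  Decreasing : Correspondence → Set ℓ
  Decreasing φ = ∀ x₁ y₁ x₂ y₂ → φ x₁ y₁ → φ x₂ y₂ → x₁ M.≤ x₂ → y₁ L.≤ y₂ →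
                 ∀ x y → x₁ M.≤ x → x M.≤ x₂ → y₁ L.≤ y → y L.≤ y₂ → φ x y

  _⊑ᶜ_ : Correspondence → Correspondence → Set ℓ
  φ ⊑ᶜ ψ = ∀ x → φ x L.⊑ ψ x

inverse : ∀ {ℓ} (M L : CompleteLinearLattice ℓ) → Correspondence M L → Correspondence L M
inverse M L φ y x = φ x y

module Submission where

-- Reading a decreasing correspondence backwards is again
-- decreasing, because the rectangle condition is symmetric in the two
-- coordinates; a horizontal segment of the graph between (a,y) and (b,y)
-- then shows that every fibre φ⁻¹(y) is an interval, nonempty by
-- surjectivity.  The core is a transfer lemma: for decreasing,
-- nonempty-valued φ, ψ, φ ⊑ ψ implies φ⁻¹ ⊑ ψ⁻¹.  Given a₁ ∈ φ⁻¹(b) and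
-- a₂ ∈ ψ⁻¹(b) with a₂ ≤ a₁ (the other order is trivial), one must put b into
-- φ(a₂) and into ψ(a₁); this is done by comparing b with some point of the
-- fibre and using either the rectangle condition or φ ⊑ ψ at that point.
-- Since inverting twice gives back the original correspondence (definitionally)
-- the converse implication is the same lemma applied to φ⁻¹, ψ⁻¹, whose
-- hypotheses are surjectivity and the decreasing property of the inverses.

open import Defs
open import Data.Product using (_×_; _,_; proj₁; proj₂)
open import Data.Sum using (inj₁; inj₂)
open import Function.Bundles using (_⇔_; mk⇔)
open import Relation.Binary.PropositionalEquality using (_≡_; refl; subst)
open import Relation.Binary.Structures using (IsTotalOrder)

module MinMax {ℓ} (A : CompleteLinearLattice ℓ) where
  open CompleteLinearLattice A
  open IsTotalOrder isTotalOrder using (antisym)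

  ∧-of-≥ : ∀ {x y} → y ≤ x → x ∧ y ≡ y
  ∧-of-≥ {x} {y} y≤x with total x y
  ... | inj₁ x≤y = antisym x≤y y≤x
  ... | inj₂ _   = refl

  ∨-of-≥ : ∀ {x y} → y ≤ x → x ∨ y ≡ x
  ∨-of-≥ {x} {y} y≤x with total x y
  ... | inj₁ x≤y = antisym y≤x x≤y
  ... | inj₂ _   = refl

-- The rectangle condition is symmetric in the coordinates, so the inverse
-- of a decreasing correspondence is decreasing.
inverse-decreasing : ∀ {ℓ} (M L : CompleteLinearLattice ℓ) (φ : Correspondence M L) →
  Decreasing M L φ → Decreasing L M (inverse M L φ)
inverse-decreasing M L φ dec y₁ x₁ y₂ x₂ p₁ p₂ y₁≤y₂ x₁≤x₂ y x y₁≤y y≤y₂ x₁≤x x≤x₂ =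
  dec x₁ y₁ x₂ y₂ p₁ p₂ x₁≤x₂ y₁≤y₂ x y x₁≤x x≤x₂ y₁≤y y≤y₂

-- Each fibre φ⁻¹(y) of a decreasing surjective correspondence is a nonempty
-- interval: between two of its points lies the degenerate rectangle
-- [a,b] × [y,y] of the graph.
inverse-interval-valued : ∀ {ℓ} (M L : CompleteLinearLattice ℓ) (φ : Correspondence M L) →
  Decreasing M L φ → Surjective M L φ → IntervalValued L M (inverse M L φ)
inverse-interval-valued M L φ dec surj y = surj y , segment
  where
  open IsTotalOrder (CompleteLinearLattice.isTotalOrder M) using (trans)
  open IsTotalOrder (CompleteLinearLattice.isTotalOrder L) using () renaming (refl to ≤-refl)

  segment : CompleteLinearLattice.IsInterval M (inverse M L φ y)
  segment a b φay φby z a≤z z≤b =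
    dec a y b y φay φby (trans a≤z z≤b) ≤-refl z y a≤z z≤b ≤-refl ≤-refl

module Transfer {ℓ} (A B : CompleteLinearLattice ℓ) (φ ψ : Correspondence A B)
                (φ⊑ψ : _⊑ᶜ_ A B φ ψ) where
  open CompleteLinearLattice A using () renaming (_≤_ to _≤ᴬ_)
  open CompleteLinearLattice B using (total) renaming (_≤_ to _≤ᴮ_)
  open IsTotalOrder (CompleteLinearLattice.isTotalOrder A) using () renaming (refl to ≤ᴬ-refl)
  open IsTotalOrder (CompleteLinearLattice.isTotalOrder B) using () renaming (refl to ≤ᴮ-refl)
  open MinMax B

  -- b ∈ φ(a₂): take b' ∈ φ(a₂).  If b' ≤ b, use the rectangle spanned by
  -- (a₂,b') and (a₁,b); if b ≤ b', then b = b' ∧ b ∈ φ(a₂) by φ(a₂) ⊑ ψ(a₂).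
  lower-point : Decreasing A B φ → (∀ a → CompleteLinearLattice.NonEmpty B (φ a)) →
    ∀ {a₁ a₂ b} → a₂ ≤ᴬ a₁ → φ a₁ b → ψ a₂ b → φ a₂ b
  lower-point dec nonempty {a₁} {a₂} {b} a₂≤a₁ φa₁b ψa₂b
    with nonempty a₂
  ... | b' , φa₂b' with total b' b
  ...   | inj₁ b'≤b = dec a₂ b' a₁ b φa₂b' φa₁b a₂≤a₁ b'≤b a₂ b ≤ᴬ-refl a₂≤a₁ b'≤b ≤ᴮ-refl
  ...   | inj₂ b≤b' = subst (φ a₂) (∧-of-≥ b≤b') (proj₁ (φ⊑ψ a₂ b' b φa₂b' ψa₂b))

  -- b ∈ ψ(a₁): take b'' ∈ ψ(a₁).  If b ≤ b'', use the rectangle spanned by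
  -- (a₂,b) and (a₁,b''); if b'' ≤ b, then b = b ∨ b'' ∈ ψ(a₁) by φ(a₁) ⊑ ψ(a₁).
  upper-point : Decreasing A B ψ → (∀ a → CompleteLinearLattice.NonEmpty B (ψ a)) →
    ∀ {a₁ a₂ b} → a₂ ≤ᴬ a₁ → φ a₁ b → ψ a₂ b → ψ a₁ b
  upper-point dec nonempty {a₁} {a₂} {b} a₂≤a₁ φa₁b ψa₂b
    with nonempty a₁
  ... | b'' , ψa₁b'' with total b b''
  ...   | inj₁ b≤b'' = dec a₂ b a₁ b'' ψa₂b ψa₁b'' a₂≤a₁ b≤b'' a₁ b a₂≤a₁ ≤ᴬ-refl ≤ᴮ-refl b≤b''
  ...   | inj₂ b''≤b = subst (ψ a₁) (∨-of-≥ b''≤b) (proj₂ (φ⊑ψ a₁ b b'' φa₁b ψa₁b''))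

-- Casing on the comparison of a₁ and a₂ computes
-- a₁ ∧ a₂ and a₁ ∨ a₂: when a₁ ≤ a₂ they are a₁ and a₂ and there is nothing to
-- prove; otherwise they are a₂ and a₁ and the pointwise steps above apply.
⊑-inverse : ∀ {ℓ} (A B : CompleteLinearLattice ℓ) (φ ψ : Correspondence A B) →
  (∀ a → CompleteLinearLattice.NonEmpty B (φ a)) →
  (∀ a → CompleteLinearLattice.NonEmpty B (ψ a)) →
  Decreasing A B φ → Decreasing A B ψ →
  _⊑ᶜ_ A B φ ψ → _⊑ᶜ_ B A (inverse A B φ) (inverse A B ψ)
⊑-inverse A B φ ψ neφ neψ decφ decψ φ⊑ψ b a₁ a₂ φa₁b ψa₂b
  with CompleteLinearLattice.total A a₁ a₂
... | inj₁ _      = φa₁b , ψa₂b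
... | inj₂ a₂≤a₁ = lower-point decφ neφ a₂≤a₁ φa₁b ψa₂b , upper-point decψ neψ a₂≤a₁ φa₁b ψa₂b
  where open Transfer A B φ ψ φ⊑ψ

-- Proposition 3.3.  The converse of the transfer lemma is the lemma itself
-- applied to φ⁻¹ and ψ⁻¹: their values are nonempty by surjectivity and they
-- are decreasing, and inverting them again returns φ and ψ.
proposition3p3 : ∀ {ℓ} (M L : CompleteLinearLattice ℓ) (φ ψ : Correspondence M L) →
    IntervalValued M L φ → IntervalValued M L ψ →
    Decreasing M L φ → Decreasing M L ψ →
    Surjective M L φ → Surjective M L ψ →
    (IntervalValued L M (inverse M L φ) × IntervalValued L M (inverse M L ψ))
    × (Decreasing L M (inverse M L φ) × Decreasing L M (inverse M L ψ))
    × (_⊑ᶜ_ M L φ ψ ⇔ _⊑ᶜ_ L M (inverse M L φ) (inverse M L ψ))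
proposition3p3 M L φ ψ ivφ ivψ decφ decψ surjφ surjψ =
  (inverse-interval-valued M L φ decφ surjφ , inverse-interval-valued M L ψ decψ surjψ) ,
  (decφ⁻¹ , decψ⁻¹) ,
  mk⇔ (⊑-inverse M L φ ψ (λ x → proj₁ (ivφ x)) (λ x → proj₁ (ivψ x)) decφ decψ)
      (⊑-inverse L M (inverse M L φ) (inverse M L ψ) surjφ surjψ decφ⁻¹ decψ⁻¹)
  where
  decφ⁻¹ : Decreasing L M (inverse M L φ)
  decφ⁻¹ = inverse-decreasing M L φ decφ
  decψ⁻¹ : Decreasing L M (inverse M L ψ)
  decψ⁻¹ = inverse-decreasing M L ψ decψ
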